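{- Define words over $\{0,1,2\}$ by $w_1=01$ and $w_i=w_{i-1}^2\big(\prod_{j=1}^{i-2}w_{i-1-j}\big)2$ for $i\ge2$, and let $w=\lim_{i\to\infty}w_i$. Then for every nonnegative integer $n$, $w[n]=0$ if and only if $n\in W_U$, where $W_U=\{\lfloor m\phi^2\rfloor\mid m\ge0\}$ and $\phi=\frac{1+\sqrt5}{2}$.
   Context: Products denote concatenation; each $w_i$ is a prefix of $w_{i+1}$, so the limit is an infinite word, indexed from $0$. Note $W_U$ includes $0$. -}

module Defs where

open import Data.Nat using (ℕ; zero; suc)
open import Data.List using (List; []; _∷_; _++_; concat; [_])
open import Data.Maybe using (Maybe; just; nothing)
open import Data.Integer using (ℤ; +_; _+_; _-_; _*_; _≤_; _<_)
open import Data.Sum using (_⊎_)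
open import Data.Product using (_×_; ∃-syntax)

Word : Set
Word = List ℕ

-- Given the list [w_{i-1}, w_{i-2}, ..., w_1], build
--   w_i = w_{i-1} w_{i-1} (w_{i-2} w_{i-3} ... w_1) 2
-- i.e. w_{i-1}^2 (∏_{j=1}^{i-2} w_{i-1-j}) 2.
nextWord : List Word → Word
nextWord []         = []   -- never used
nextWord (x ∷ rest) = x ++ x ++ concat rest ++ [ 2 ]

-- history k = [w_{k+1}, w_k, ..., w_1]
history : ℕ → List Word
history zero    = [ 0 ∷ 1 ∷ [] ]
history (suc k) = nextWord (history k) ∷ history k

-- w i  is the paper's w_i (for i ≥ 1); w 0 is an unused dummy.
w : ℕ → Word
w zero    = []
w (suc k) with history k
... | []    = []
... | x ∷ _ = x

letterAt : Word → ℕ → Maybe ℕ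
letterAt []       _       = nothing
letterAt (a ∷ _)  zero    = just a
letterAt (_ ∷ as) (suc n) = letterAt as n

-- The limit word w = lim w_i.  Each w_i is a prefix of w_{i+1} (given),
-- and |w_{n+1}| ≥ n+2, so w[n] is the n-th letter of w_{n+1}.
wLim : ℕ → Maybe ℕ
wLim n = letterAt (w (suc n)) n

-- IsFloorMulPhiSq m k  :⇔  k = ⌊ m φ² ⌋,  φ = (1+√5)/2, so m φ² = (3m + m√5)/2.
-- Stated via the defining inequalities of the floor, k ≤ mφ² < k+1, in exact
-- integer arithmetic:
--   k ≤ mφ²     ⇔  2k-3m ≤ m√5  ⇔  2k-3m ≤ 0  or  (2k-3m)² ≤ 5m²
--   mφ² < k+1   ⇔  m√5 < 2k+2-3m ⇔ 0 < 2k+2-3m and 5m² < (2k+2-3m)²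
IsFloorMulPhiSq : ℕ → ℕ → Set
IsFloorMulPhiSq m k =
  ((a ≤ + 0) ⊎ (a * a ≤ + 5 * (M * M)))
  × ((+ 0 < b) × (+ 5 * (M * M) < b * b))
  where
    M : ℤ
    M = + m
    a : ℤ
    a = + 2 * + k - + 3 * M
    b : ℤ
    b = a + + 2

InWU : ℕ → Set
InWU n = ∃[ m ] IsFloorMulPhiSq m n

-- The limit word is the fixed point of the morphism σ : 0 ↦ 01, 1 ↦ 012, 2 ↦ 012, so it is
-- the concatenation of the blocks σ(w[0]) σ(w[1]) …, and w[p] = 0 exactly when p is the
-- start of a block.  Block q starts at G q = ⌊qφ²⌋: both sequences start at 0 and grow by 2
-- exactly when q is itself a block start, resp. a value of G.  For G this is the
-- self-similarity of the Beatty sequence ⌊qφ²⌋, which comes from multiplication by the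
-- unit φ⁻² = (3 − √5)/2 in ℤ[√5]: writing 2 G q = 3q + a with a ≤ q√5 < a + 2, the value
-- c = 3q − G q satisfies G (c − 1) < q ≤ G c.
module Submission where

open import Defs
open import Data.Nat
  using (ℕ; zero; suc; _+_; _*_; _∸_; _≤_; _<_; _≤′_; ≤′-refl; ≤′-step; z≤n; s≤s; _≤?_; _<?_)
open import Data.Nat.Properties
open import Data.Nat.Induction using (<-rec)
open import Data.Nat.Tactic.RingSolver using (solve)
open import Data.Integer as ℤ using (ℤ; +_; -[1+_]; +≤+; +<+; -<+)
import Data.Integer.Properties as ℤP
import Data.Integer.Tactic.RingSolver as ℤSolver
open import Data.List using ([]; _∷_; _++_; concat; concatMap; [_]; length)
open import Data.List.Properties using (++-assoc; ++-identityʳ; length-++; length-++-≤ˡ; concatMap-++)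
open import Data.Maybe using (Maybe; just; nothing)
open import Data.Product using (_×_; _,_; proj₁; proj₂; ∃-syntax)
open import Data.Sum using (_⊎_; inj₁; inj₂)
open import Data.Empty using (⊥-elim)
open import Function using (_∘_)
open import Function.Bundles using (_⇔_; mk⇔; Equivalence)
open import Function.Construct.Composition using (_⇔-∘_)
open import Function.Construct.Symmetry using (⇔-sym)
open import Relation.Binary using (tri<; tri≈; tri>)
open import Relation.Binary.PropositionalEquality hiding ([_])
open import Relation.Nullary using (¬_; Dec; yes; no)

-- The limit word as a fixed point of σ

σ : ℕ → Word
σ zero    = 0 ∷ 1 ∷ []
σ (suc _) = 0 ∷ 1 ∷ 2 ∷ []

-- W k = w_{k+1} and T k = w_k w_{k-1} ⋯ w_1 2.
W T : ℕ → Word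
W zero    = 0 ∷ 1 ∷ []
W (suc k) = W k ++ W k ++ T k
T zero    = [ 2 ]
T (suc k) = W k ++ T k

history-shape : ∀ k → ∃[ rest ] history k ≡ W k ∷ rest × concat rest ++ [ 2 ] ≡ T k
history-shape zero = [] , refl , refl
history-shape (suc k) with history-shape k
... | rest , history≡ , tail≡ rewrite history≡ =
  W k ∷ rest ,
  cong (λ t → (W k ++ W k ++ t) ∷ W k ∷ rest) tail≡ ,
  trans (++-assoc (W k) (concat rest) [ 2 ]) (cong (W k ++_) tail≡)

w-suc : ∀ k → w (suc k) ≡ W k
w-suc k rewrite proj₁ (proj₂ (history-shape k)) = refl

σ-W-T : ∀ k → concatMap σ (W k) ≡ W (suc k) × concatMap σ (T k) ≡ T (suc k)
σ-W-T zero = refl , refl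
σ-W-T (suc k) with σ-W-T k
... | σW≡ , σT≡ = σW'≡ , σT'≡
  where
  open ≡-Reasoning
  σW'≡ : concatMap σ (W k ++ W k ++ T k) ≡ W (suc k) ++ W (suc k) ++ T (suc k)
  σW'≡ = begin
    concatMap σ (W k ++ W k ++ T k)
      ≡⟨ concatMap-++ σ (W k) (W k ++ T k) ⟩
    concatMap σ (W k) ++ concatMap σ (W k ++ T k)
      ≡⟨ cong (concatMap σ (W k) ++_) (concatMap-++ σ (W k) (T k)) ⟩
    concatMap σ (W k) ++ concatMap σ (W k) ++ concatMap σ (T k)
      ≡⟨ cong₂ (λ u t → u ++ u ++ t) σW≡ σT≡ ⟩
    W (suc k) ++ W (suc k) ++ T (suc k) ∎
  σT'≡ : concatMap σ (W k ++ T k) ≡ W (suc k) ++ T (suc k)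
  σT'≡ = trans (concatMap-++ σ (W k) (T k)) (cong₂ _++_ σW≡ σT≡)

length-W : ∀ k → k < length (W k)
length-W zero    = s≤s z≤n
length-W (suc k) = begin-strict
  suc k                               ≡⟨ +-comm 1 k ⟩
  k + 1                               <⟨ +-mono-<-≤ (length-W k) 1≤∣W++T∣ ⟩
  length (W k) + length (W k ++ T k)  ≡⟨ length-++ (W k) ⟨
  length (W (suc k))                  ∎
  where
  open ≤-Reasoning
  1≤∣W++T∣ : 1 ≤ length (W k ++ T k)
  1≤∣W++T∣ = ≤-trans (≤-trans (s≤s z≤n) (length-W k)) (length-++-≤ˡ (W k))

W-extends : ∀ {k k′} → k ≤′ k′ → ∃[ rest ] W k′ ≡ W k ++ rest
W-extends ≤′-refl = [] , sym (++-identityʳ _)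
W-extends {k} (≤′-step {n} k≤n) with W-extends k≤n
... | rest , Wn≡ = rest ++ W n ++ T n , (begin
  W n ++ W n ++ T n            ≡⟨ cong (_++ W n ++ T n) Wn≡ ⟩
  (W k ++ rest) ++ W n ++ T n  ≡⟨ ++-assoc (W k) rest (W n ++ T n) ⟩
  W k ++ rest ++ W n ++ T n    ∎)
  where open ≡-Reasoning

letterAt-++ : ∀ xs ys {i} → i < length xs → letterAt (xs ++ ys) i ≡ letterAt xs i
letterAt-++ (x ∷ xs) ys {zero}  _         = refl
letterAt-++ (x ∷ xs) ys {suc i} (s≤s i<n) = letterAt-++ xs ys i<n

letterAt-W-mono : ∀ {k k′ i} → k ≤ k′ → i < length (W k) → letterAt (W k′) i ≡ letterAt (W k) i
letterAt-W-mono {k} {i = i} k≤k′ i<∣Wk∣ with W-extends (≤⇒≤′ k≤k′)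
... | rest , Wk′≡ = trans (cong (λ u → letterAt u i) Wk′≡) (letterAt-++ (W k) rest i<∣Wk∣)

wLim-W : ∀ i → wLim i ≡ letterAt (W i) i
wLim-W i = cong (λ u → letterAt u i) (w-suc i)

letterAt-W : ∀ {k i} → i < length (W k) → letterAt (W k) i ≡ wLim i
letterAt-W {k} {i} i<∣Wk∣ with ≤-total k i
... | inj₁ k≤i = trans (sym (letterAt-W-mono k≤i i<∣Wk∣)) (sym (wLim-W i))
... | inj₂ i≤k = trans (letterAt-W-mono i≤k (length-W i)) (sym (wLim-W i))

wLim-σ : ∀ p → wLim p ≡ letterAt (concatMap σ (W p)) p
wLim-σ p = trans (sym (letterAt-W {k = suc p} (<-trans (n<1+n p) (length-W (suc p)))))
                 (cong (λ u → letterAt u p) (sym (proj₁ (σ-W-T p))))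

-- Block starts in σ-images

blockLength : Maybe ℕ → ℕ
blockLength (just zero) = 2
blockLength _           = 3

blockLength-≢0 : ∀ {x} → x ≢ just 0 → blockLength x ≡ 3
blockLength-≢0 {just zero}    x≢0 = ⊥-elim (x≢0 refl)
blockLength-≢0 {just (suc _)} _   = refl
blockLength-≢0 {nothing}      _   = refl

-- The position of σ(f j) in σ(f 0) σ(f 1) ⋯ (blockLength (just x) is the length of σ x).
blockStart : (ℕ → Maybe ℕ) → ℕ → ℕ
blockStart f zero    = 0
blockStart f (suc j) = blockLength (f 0) + blockStart (f ∘ suc) j

blockStart-suc : ∀ f j → blockStart f (suc j) ≡ blockStart f j + blockLength (f j)
blockStart-suc f zero    = +-identityʳ (blockLength (f 0))
blockStart-suc f (suc j) = trans (cong (_+_ (blockLength (f 0))) (blockStart-suc (f ∘ suc) j))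
                                 (sym (+-assoc (blockLength (f 0)) _ _))

blockStart-cong : ∀ {f g} j → (∀ {i} → i < j → f i ≡ g i) → blockStart f j ≡ blockStart g j
blockStart-cong zero    _   = refl
blockStart-cong (suc j) f≗g =
  cong₂ _+_ (cong blockLength (f≗g (s≤s z≤n))) (blockStart-cong j (f≗g ∘ s≤s))

j≤blockStart : ∀ f j → j ≤ blockStart f j
j≤blockStart f zero    = z≤n
j≤blockStart f (suc j) = +-mono-≤ (1≤blockLength (f 0)) (j≤blockStart (f ∘ suc) j)
  where
  1≤blockLength : ∀ x → 1 ≤ blockLength x
  1≤blockLength (just zero)    = s≤s z≤n
  1≤blockLength (just (suc _)) = s≤s z≤n
  1≤blockLength nothing        = s≤s z≤n

σ*-zero⇒blockStart : ∀ v p → letterAt (concatMap σ v) p ≡ just 0 →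
                     ∃[ j ] j < length v × blockStart (letterAt v) j ≡ p
σ*-zero⇒blockStart (x ∷ v)     zero                _ = 0 , s≤s z≤n , refl
σ*-zero⇒blockStart (zero ∷ v)  (suc zero)          ()
σ*-zero⇒blockStart (zero ∷ v)  (suc (suc p))       e with σ*-zero⇒blockStart v p e
... | j , j<∣v∣ , refl = suc j , s≤s j<∣v∣ , refl
σ*-zero⇒blockStart (suc _ ∷ v) (suc zero)          ()
σ*-zero⇒blockStart (suc _ ∷ v) (suc (suc zero))    ()
σ*-zero⇒blockStart (suc _ ∷ v) (suc (suc (suc p))) e with σ*-zero⇒blockStart v p e
... | j , j<∣v∣ , refl = suc j , s≤s j<∣v∣ , refl

σ*-zero-at-blockStart : ∀ v j → j < length v → letterAt (concatMap σ v) (blockStart (letterAt v) j) ≡ just 0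
σ*-zero-at-blockStart (zero ∷ v)  zero    _         = refl
σ*-zero-at-blockStart (suc _ ∷ v) zero    _         = refl
σ*-zero-at-blockStart (zero ∷ v)  (suc j) (s≤s j<n) = σ*-zero-at-blockStart v j j<n
σ*-zero-at-blockStart (suc _ ∷ v) (suc j) (s≤s j<n) = σ*-zero-at-blockStart v j j<n

wLim-zero⇒blockStart : ∀ p → wLim p ≡ just 0 → ∃[ j ] blockStart wLim j ≡ p
wLim-zero⇒blockStart p e with σ*-zero⇒blockStart (W p) p (trans (sym (wLim-σ p)) e)
... | j , j<∣Wp∣ , start≡p =
  j , trans (blockStart-cong j (λ i<j → sym (letterAt-W {k = p} (<-trans i<j j<∣Wp∣)))) start≡p

wLim-zero-at-blockStart : ∀ j → wLim (blockStart wLim j) ≡ just 0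
wLim-zero-at-blockStart j = begin
  wLim p
    ≡⟨ wLim-σ p ⟩
  letterAt (concatMap σ (W p)) p
    ≡⟨ cong (letterAt (concatMap σ (W p))) start≡p ⟨
  letterAt (concatMap σ (W p)) (blockStart (letterAt (W p)) j)
    ≡⟨ σ*-zero-at-blockStart (W p) j j<∣Wp∣ ⟩
  just 0 ∎
  where
  open ≡-Reasoning
  p = blockStart wLim j
  j<∣Wp∣ : j < length (W p)
  j<∣Wp∣ = ≤-<-trans (j≤blockStart wLim j) (length-W p)
  start≡p : blockStart (letterAt (W p)) j ≡ p
  start≡p = blockStart-cong j (λ i<j → letterAt-W {k = p} (<-trans i<j j<∣Wp∣))

-- The sequence ⌊qφ²⌋

square-cancel-≤ : ∀ {m n} → m * m ≤ n * n → m ≤ n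
square-cancel-≤ m²≤n² = ≮⇒≥ (λ n<m → <⇒≱ (*-mono-< n<m n<m) m²≤n²)

square-cancel-< : ∀ {m n} → m * m < n * n → m < n
square-cancel-< m²<n² = ≰⇒> (λ n≤m → <⇒≱ m²<n² (*-mono-≤ n≤m n≤m))

Bracket : ℕ → ℕ → Set
Bracket q a = a * a ≤ 5 * (q * q) × 5 * (q * q) < (2 + a) * (2 + a)

bracket-lower-step : ∀ {q a} → a * a ≤ 5 * (q * q) → (1 + a) * (1 + a) ≤ 5 * (suc q * suc q)
bracket-lower-step {q} {a} a≤q√5 = begin
  (1 + a) * (1 + a)                ≡⟨ solve (a ∷ []) ⟩
  a * a + (2 * a + 1)              ≤⟨ +-mono-≤ a≤q√5 (+-monoˡ-≤ 1 (*-monoʳ-≤ 2 a≤5q)) ⟩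
  5 * (q * q) + (2 * (5 * q) + 1)  ≤⟨ +-monoʳ-≤ (5 * (q * q)) (+-monoʳ-≤ (2 * (5 * q)) (s≤s z≤n)) ⟩
  5 * (q * q) + (2 * (5 * q) + 5)  ≡⟨ solve (q ∷ []) ⟩
  5 * (suc q * suc q)              ∎
  where
  open ≤-Reasoning
  a≤5q : a ≤ 5 * q
  a≤5q = square-cancel-≤ (begin
    a * a              ≤⟨ a≤q√5 ⟩
    5 * (q * q)        ≤⟨ *-monoˡ-≤ (q * q) (m≤m+n 5 20) ⟩
    25 * (q * q)       ≡⟨ solve (q ∷ []) ⟩
    (5 * q) * (5 * q)  ∎)

bracket-upper-step : ∀ {q b} → 5 * (q * q) < b * b → 5 * (suc q * suc q) < (3 + b) * (3 + b)
bracket-upper-step {q} {b} q√5<b = begin-strict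
  5 * (suc q * suc q)              ≡⟨ solve (q ∷ []) ⟩
  5 * (q * q) + 10 * q + 5         <⟨ +-mono-<-≤ (+-mono-<-≤ q√5<b 10q≤6b) (m≤m+n 5 4) ⟩
  b * b + 6 * b + 9                ≡⟨ solve (b ∷ []) ⟩
  (3 + b) * (3 + b)                ∎
  where
  open ≤-Reasoning
  10q≤6b : 10 * q ≤ 6 * b
  10q≤6b = square-cancel-≤ (begin
    (10 * q) * (10 * q)  ≡⟨ solve (q ∷ []) ⟩
    100 * (q * q)        ≤⟨ *-monoˡ-≤ (q * q) (m≤m+n 100 80) ⟩
    180 * (q * q)        ≡⟨ solve (q ∷ []) ⟩
    36 * (5 * (q * q))   ≤⟨ *-monoʳ-≤ 36 (<⇒≤ q√5<b) ⟩
    36 * (b * b)         ≡⟨ solve (b ∷ []) ⟩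
    (6 * b) * (6 * b)    ∎)

-- α q = 2 G q − 3q; G takes the long step 3 exactly when α can advance by 3 and stay ≤ (q+1)√5.
α : ℕ → ℕ
long? : ∀ q → Dec ((3 + α q) * (3 + α q) ≤ 5 * (suc q * suc q))

α zero = 0
α (suc q) with long? q
... | yes _ = 3 + α q
... | no _  = 1 + α q

long? q = (3 + α q) * (3 + α q) ≤? 5 * (suc q * suc q)

G : ℕ → ℕ
G zero = 0
G (suc q) with long? q
... | yes _ = 3 + G q
... | no _  = 2 + G q

α-bracket : ∀ q → Bracket q (α q)
α-bracket zero = z≤n , s≤s z≤n
α-bracket (suc q) with long? q | α-bracket q
... | yes long | _ , upper = long , bracket-upper-step {q} {2 + α q} upper
... | no short | lower , _ = bracket-lower-step {q} {α q} lower , ≰⇒> short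

2g≡3q+a-step : ∀ {q g a} d e → 2 * g ≡ 3 * q + a → 2 * d ≡ 3 + e → 2 * (d + g) ≡ 3 * suc q + (e + a)
2g≡3q+a-step {q} {g} {a} d e 2g≡ 2d≡ = begin
  2 * (d + g)          ≡⟨ *-distribˡ-+ 2 d g ⟩
  2 * d + 2 * g        ≡⟨ cong₂ _+_ 2d≡ 2g≡ ⟩
  3 + e + (3 * q + a)  ≡⟨ solve (q ∷ e ∷ a ∷ []) ⟩
  3 * suc q + (e + a)  ∎
  where open ≡-Reasoning

2G≡3q+α : ∀ q → 2 * G q ≡ 3 * q + α q
2G≡3q+α zero = refl
2G≡3q+α (suc q) with long? q
... | yes _ = 2g≡3q+a-step 3 3 (2G≡3q+α q) refl
... | no _  = 2g≡3q+a-step 2 1 (2G≡3q+α q) refl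

G-step : ∀ q → G (suc q) ≡ 2 + G q ⊎ G (suc q) ≡ 3 + G q
G-step q with long? q
... | yes _ = inj₂ refl
... | no _  = inj₁ refl

2+G≤G-suc : ∀ q → 2 + G q ≤ G (suc q)
2+G≤G-suc q with G-step q
... | inj₁ jump≡ = ≤-reflexive (sym jump≡)
... | inj₂ jump≡ = ≤-trans (n≤1+n (2 + G q)) (≤-reflexive (sym jump≡))

G-suc≤3+G : ∀ q → G (suc q) ≤ 3 + G q
G-suc≤3+G q with G-step q
... | inj₁ jump≡ = ≤-trans (≤-reflexive jump≡) (n≤1+n (2 + G q))
... | inj₂ jump≡ = ≤-reflexive jump≡

G-mono-≤ : ∀ {m n} → m ≤ n → G m ≤ G n
G-mono-≤ = mono ∘ ≤⇒≤′
  where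
  mono : ∀ {m n} → m ≤′ n → G m ≤ G n
  mono ≤′-refl           = ≤-refl
  mono (≤′-step {n} m≤n) = ≤-trans (mono m≤n) (≤-trans (m≤n+m (G n) 2) (2+G≤G-suc n))

n≤G : ∀ n → n ≤ G n
n≤G zero    = z≤n
n≤G (suc n) = ≤-trans (s≤s (≤-trans (n≤G n) (n≤1+n (G n)))) (2+G≤G-suc n)

G≤3n : ∀ n → G n ≤ 3 * n
G≤3n zero    = z≤n
G≤3n (suc n) = begin
  G (suc n)  ≤⟨ G-suc≤3+G n ⟩
  3 + G n    ≤⟨ +-monoʳ-≤ 3 (G≤3n n) ⟩
  3 + 3 * n  ≡⟨ *-suc 3 n ⟨
  3 * suc n  ∎
  where open ≤-Reasoning

-- y + c√5 = φ⁻² (a + q√5) with φ⁻² = (3 − √5)/2 of norm 1, so the norm y² − 5c² equals a² − 5q².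
norm-identity : ∀ {y c q a} → 3 * c + y ≡ 2 * q → a + 2 * c ≡ 3 * q →
                y * y + 5 * (q * q) ≡ 5 * (c * c) + a * a
norm-identity {y} {c} {q} {a} 3c+y≡2q a+2c≡3q = *-cancelˡ-≡ _ _ 4 (begin
  4 * (y * y + 5 * (q * q))                         ≡⟨ solve (y ∷ q ∷ []) ⟩
  4 * (y * y) + 5 * ((2 * q) * (2 * q))             ≡⟨ cong (λ t → 4 * (y * y) + 5 * (t * t)) 3c+y≡2q ⟨
  4 * (y * y) + 5 * ((3 * c + y) * (3 * c + y))     ≡⟨ solve (y ∷ c ∷ []) ⟩
  (3 * y + 5 * c) * (3 * y + 5 * c) + 20 * (c * c)  ≡⟨ cong (λ t → t * t + 20 * (c * c)) 2a≡3y+5c ⟨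
  (2 * a) * (2 * a) + 20 * (c * c)                  ≡⟨ solve (a ∷ c ∷ []) ⟩
  4 * (5 * (c * c) + a * a)                         ∎)
  where
  open ≡-Reasoning
  2a≡3y+5c : 2 * a ≡ 3 * y + 5 * c
  2a≡3y+5c = +-cancelʳ-≡ (4 * c) _ _ (begin
    2 * a + 4 * c        ≡⟨ solve (a ∷ c ∷ []) ⟩
    2 * (a + 2 * c)      ≡⟨ cong (2 *_) a+2c≡3q ⟩
    2 * (3 * q)          ≡⟨ solve (q ∷ []) ⟩
    3 * (2 * q)          ≡⟨ cong (3 *_) 3c+y≡2q ⟨
    3 * (3 * c + y)      ≡⟨ solve (y ∷ c ∷ []) ⟩
    3 * y + 5 * c + 4 * c ∎)

-- By norm-identity, y = 2q − 3c lies on the same side of c√5 as a does of q√5; comparing y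
-- with the bracket a′ of c then locates q relative to g = (3c + a′)/2.
transfer-≥ : ∀ {q c a a′ g} → a * a ≤ 5 * (q * q) → a + 2 * c ≡ 3 * q →
             5 * (c * c) < (2 + a′) * (2 + a′) → 2 * g ≡ 3 * c + a′ → q ≤ g
transfer-≥ {q} {c} {a} {a′} {g} a≤q√5 a+2c≡3q c√5<2+a′ 2g≡3c+a′ = ≮⇒≥ g≮q
  where
  g≮q : ¬ g < q
  g≮q g<q = <⇒≱ c√5<2+a′ (≤-trans (*-mono-≤ 2+a′≤y 2+a′≤y) y≤c√5)
    where
    open ≤-Reasoning
    bound : 3 * c + (2 + a′) ≤ 2 * q
    bound = begin
      3 * c + (2 + a′)  ≡⟨ solve (c ∷ a′ ∷ []) ⟩
      2 + (3 * c + a′)  ≡⟨ cong (λ t → 2 + t) 2g≡3c+a′ ⟨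
      2 + 2 * g         ≡⟨ *-suc 2 g ⟨
      2 * suc g         ≤⟨ *-monoʳ-≤ 2 g<q ⟩
      2 * q             ∎
    y = 2 * q ∸ 3 * c
    3c+y≡2q : 3 * c + y ≡ 2 * q
    3c+y≡2q = m+[n∸m]≡n (≤-trans (m≤m+n (3 * c) (2 + a′)) bound)
    2+a′≤y : 2 + a′ ≤ y
    2+a′≤y = +-cancelˡ-≤ (3 * c) _ _ (≤-trans bound (≤-reflexive (sym 3c+y≡2q)))
    y≤c√5 : y * y ≤ 5 * (c * c)
    y≤c√5 = +-cancelʳ-≤ (5 * (q * q)) _ _ (begin
      y * y + 5 * (q * q)        ≡⟨ norm-identity {y} {c} {q} {a} 3c+y≡2q a+2c≡3q ⟩
      5 * (c * c) + a * a        ≤⟨ +-monoʳ-≤ (5 * (c * c)) a≤q√5 ⟩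
      5 * (c * c) + 5 * (q * q)  ∎)

transfer-< : ∀ {q c b a′ g} → 5 * (q * q) < b * b → b + 2 * c ≡ 3 * q →
             a′ * a′ ≤ 5 * (c * c) → 2 * g ≡ 3 * c + a′ → g < q
transfer-< {q} {c} {b} {a′} {g} q√5<b b+2c≡3q a′≤c√5 2g≡3c+a′ = ≰⇒> q≰g
  where
  3c<2q : 3 * c < 2 * q
  3c<2q = *-cancelˡ-< 2 _ _ (+-cancelʳ-< (5 * q) _ _ (begin-strict
    2 * (3 * c) + 5 * q  <⟨ +-monoʳ-< (2 * (3 * c)) 5q<3b ⟩
    2 * (3 * c) + 3 * b  ≡⟨ solve (c ∷ b ∷ []) ⟩
    3 * (b + 2 * c)      ≡⟨ cong (3 *_) b+2c≡3q ⟩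
    3 * (3 * q)          ≡⟨ solve (q ∷ []) ⟩
    2 * (2 * q) + 5 * q  ∎))
    where
    open ≤-Reasoning
    5q<3b : 5 * q < 3 * b
    5q<3b = square-cancel-< (begin-strict
      (5 * q) * (5 * q)  ≡⟨ solve (q ∷ []) ⟩
      25 * (q * q)       ≤⟨ *-monoˡ-≤ (q * q) (m≤m+n 25 20) ⟩
      45 * (q * q)       ≡⟨ solve (q ∷ []) ⟩
      9 * (5 * (q * q))  <⟨ *-monoʳ-< 9 q√5<b ⟩
      9 * (b * b)        ≡⟨ solve (b ∷ []) ⟩
      (3 * b) * (3 * b)  ∎)
  y = 2 * q ∸ 3 * c
  3c+y≡2q : 3 * c + y ≡ 2 * q
  3c+y≡2q = m+[n∸m]≡n (<⇒≤ 3c<2q)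
  q≰g : ¬ q ≤ g
  q≰g q≤g = <⇒≱ c√5<y (≤-trans (*-mono-≤ y≤a′ y≤a′) a′≤c√5)
    where
    open ≤-Reasoning
    y≤a′ : y ≤ a′
    y≤a′ = +-cancelˡ-≤ (3 * c) _ _ (begin
      3 * c + y   ≡⟨ 3c+y≡2q ⟩
      2 * q       ≤⟨ *-monoʳ-≤ 2 q≤g ⟩
      2 * g       ≡⟨ 2g≡3c+a′ ⟩
      3 * c + a′  ∎)
    c√5<y : 5 * (c * c) < y * y
    c√5<y = +-cancelʳ-< (5 * (q * q)) _ _ (begin-strict
      5 * (c * c) + 5 * (q * q)  <⟨ +-monoʳ-< (5 * (c * c)) q√5<b ⟩
      5 * (c * c) + b * b        ≡⟨ norm-identity {y} {c} {q} {b} 3c+y≡2q b+2c≡3q ⟨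
      y * y + 5 * (q * q)        ∎)

α+2c≡3q : ∀ {q c} → G q + c ≡ 3 * q → α q + 2 * c ≡ 3 * q
α+2c≡3q {q} {c} Gq+c≡3q = +-cancelˡ-≡ (3 * q) _ _ (begin
  3 * q + (α q + 2 * c)  ≡⟨ +-assoc (3 * q) (α q) (2 * c) ⟨
  3 * q + α q + 2 * c    ≡⟨ cong (λ t → t + 2 * c) (2G≡3q+α q) ⟨
  2 * G q + 2 * c        ≡⟨ *-distribˡ-+ 2 (G q) c ⟨
  2 * (G q + c)          ≡⟨ cong (2 *_) Gq+c≡3q ⟩
  2 * (3 * q)            ≡⟨ solve (q ∷ []) ⟩
  3 * q + 3 * q          ∎)
  where open ≡-Reasoning

-- With G q + c ≡ 3q, c counts the r with G r < q.
G-above : ∀ {q c r} → G q + c ≡ 3 * q → c ≤ r → q ≤ G r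
G-above {q} {c} Gq+c≡3q c≤r = ≤-trans q≤Gc (G-mono-≤ c≤r)
  where
  q≤Gc : q ≤ G c
  q≤Gc = transfer-≥ {q} {c} {α q} {α c} {G c}
           (proj₁ (α-bracket q)) (α+2c≡3q {q} {c} Gq+c≡3q) (proj₂ (α-bracket c)) (2G≡3q+α c)

G-below : ∀ {q c r} → G q + c ≡ 3 * q → r < c → G r < q
G-below {q} {suc c} Gq+c≡3q (s≤s r≤c) = ≤-<-trans (G-mono-≤ r≤c) Gc<q
  where
  2+α+2c≡3q : 2 + α q + 2 * c ≡ 3 * q
  2+α+2c≡3q = begin
    2 + α q + 2 * c    ≡⟨ trans (+-suc (α q) (suc (2 * c))) (cong suc (+-suc (α q) (2 * c))) ⟨
    α q + (2 + 2 * c)  ≡⟨ cong (_+_ (α q)) (*-suc 2 c) ⟨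
    α q + 2 * suc c    ≡⟨ α+2c≡3q {q} {suc c} Gq+c≡3q ⟩
    3 * q              ∎
    where open ≡-Reasoning
  Gc<q : G c < q
  Gc<q = transfer-< {q} {c} {2 + α q} {α c} {G c}
           (proj₂ (α-bracket q)) 2+α+2c≡3q (proj₁ (α-bracket c)) (2G≡3q+α c)

G-jump2⇔inRange : ∀ q → G (suc q) ≡ 2 + G q ⇔ (∃[ r ] G r ≡ q)
G-jump2⇔inRange q with m≤n⇒∃[o]m+o≡n (G≤3n q)
... | c , Gq+c≡3q = mk⇔ inRange shortJump
  where
  open ≡-Reasoning
  inRange : G (suc q) ≡ 2 + G q → ∃[ r ] G r ≡ q
  inRange jump≡ = c , ≤-antisym (≤-pred (G-below next (n<1+n c))) (G-above Gq+c≡3q ≤-refl)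
    where
    next : G (suc q) + suc c ≡ 3 * suc q
    next = begin
      G (suc q) + suc c  ≡⟨ cong (λ t → t + suc c) jump≡ ⟩
      2 + G q + suc c    ≡⟨ cong (λ t → 2 + t) (+-suc (G q) c) ⟩
      3 + (G q + c)      ≡⟨ cong (λ t → 3 + t) Gq+c≡3q ⟩
      3 + 3 * q          ≡⟨ *-suc 3 q ⟨
      3 * suc q          ∎
  shortJump : ∃[ r ] G r ≡ q → G (suc q) ≡ 2 + G q
  shortJump (r , Gr≡q) with G-step q
  ... | inj₁ jump≡ = jump≡
  ... | inj₂ jump≡ with r <? c
  ...   | yes r<c = ⊥-elim (<⇒≢ (G-below Gq+c≡3q r<c) Gr≡q)
  ...   | no r≮c  = ⊥-elim (<⇒≱ (G-above next (≮⇒≥ r≮c)) (≤-reflexive Gr≡q))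
    where
    next : G (suc q) + c ≡ 3 * suc q
    next = begin
      G (suc q) + c  ≡⟨ cong (λ t → t + c) jump≡ ⟩
      3 + (G q + c)  ≡⟨ cong (λ t → 3 + t) Gq+c≡3q ⟩
      3 + 3 * q      ≡⟨ *-suc 3 q ⟨
      3 * suc q      ∎

-- The blocks of w start at the values of G

wLim-zero⇔inRange : ∀ p → (∀ {j} → j ≤ p → blockStart wLim j ≡ G j) →
                    wLim p ≡ just 0 ⇔ (∃[ j ] G j ≡ p)
wLim-zero⇔inRange p start≡G = mk⇔ inRange zero-at
  where
  inRange : wLim p ≡ just 0 → ∃[ j ] G j ≡ p
  inRange wp≡0 with wLim-zero⇒blockStart p wp≡0
  ... | j , start≡p = j , trans (sym (start≡G (subst (j ≤_) start≡p (j≤blockStart wLim j)))) start≡p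
  zero-at : ∃[ j ] G j ≡ p → wLim p ≡ just 0
  zero-at (j , Gj≡p) =
    subst (λ t → wLim t ≡ just 0) (trans (start≡G (subst (j ≤_) Gj≡p (n≤G j))) Gj≡p)
          (wLim-zero-at-blockStart j)

blockLength-jump : ∀ {a b} x → b ≡ 2 + a ⊎ b ≡ 3 + a → (x ≡ just 0 ⇔ b ≡ 2 + a) →
                   b ≡ blockLength x + a
blockLength-jump x (inj₁ b≡2+a) x≡0⇔ rewrite Equivalence.from x≡0⇔ b≡2+a = b≡2+a
blockLength-jump {a} {b} x (inj₂ b≡3+a) x≡0⇔ = subst (λ l → b ≡ l + a) (sym (blockLength-≢0 x≢0)) b≡3+a
  where
  x≢0 : x ≢ just 0
  x≢0 x≡0 = <⇒≢ (n<1+n (2 + a)) (trans (sym (Equivalence.to x≡0⇔ x≡0)) b≡3+a)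

blockStart-wLim≡G : ∀ q → blockStart wLim q ≡ G q
blockStart-wLim≡G = <-rec _ step
  where
  step : ∀ q → (∀ {j} → j < q → blockStart wLim j ≡ G j) → blockStart wLim q ≡ G q
  step zero    _  = refl
  step (suc q) ih = begin
    blockStart wLim (suc q)                   ≡⟨ blockStart-suc wLim q ⟩
    blockStart wLim q + blockLength (wLim q)  ≡⟨ cong (λ t → t + blockLength (wLim q)) (ih ≤-refl) ⟩
    G q + blockLength (wLim q)                ≡⟨ +-comm (G q) _ ⟩
    blockLength (wLim q) + G q                ≡⟨ blockLength-jump (wLim q) (G-step q) zero⇔jump ⟨
    G (suc q)                                 ∎
    where
    open ≡-Reasoning
    zero⇔jump : wLim q ≡ just 0 ⇔ G (suc q) ≡ 2 + G q
    zero⇔jump = ⇔-sym (G-jump2⇔inRange q) ⇔-∘ wLim-zero⇔inRange q (λ j≤q → ih (s≤s j≤q))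

-- Floors in ℤ

-- y ≤ m√5, resp. m√5 < x, written as in IsFloorMulPhiSq, which unfolds to
-- BelowRoot5 q (offset q k) × AboveRoot5 q (offset q k ℤ.+ + 2).
BelowRoot5 : ℕ → ℤ → Set
BelowRoot5 m y = (y ℤ.≤ + 0) ⊎ (y ℤ.* y ℤ.≤ + 5 ℤ.* (+ m ℤ.* + m))

AboveRoot5 : ℕ → ℤ → Set
AboveRoot5 m x = (+ 0 ℤ.< x) × (+ 5 ℤ.* (+ m ℤ.* + m) ℤ.< x ℤ.* x)

offset : ℕ → ℕ → ℤ
offset q k = + 2 ℤ.* + k ℤ.- + 3 ℤ.* + q

pos-square : ∀ n → + n ℤ.* + n ≡ + (n * n)
pos-square n = sym (ℤP.pos-* n n)

pos-5square : ∀ m → + 5 ℤ.* (+ m ℤ.* + m) ≡ + (5 * (m * m))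
pos-5square m = trans (cong (λ t → + 5 ℤ.* t) (pos-square m)) (sym (ℤP.pos-* 5 (m * m)))

belowRoot5<aboveRoot5 : ∀ {m y x} → BelowRoot5 m y → AboveRoot5 m x → y ℤ.< x
belowRoot5<aboveRoot5 {x = + zero}   _ (+<+ () , _)
belowRoot5<aboveRoot5 {x = -[1+ _ ]} _ (() , _)
belowRoot5<aboveRoot5 {y = -[1+ _ ]} {+ suc _} _ _ = -<+
belowRoot5<aboveRoot5 {y = + y} {+ suc x} (inj₁ (+≤+ y≤0)) _ = +<+ (s≤s (≤-trans y≤0 z≤n))
belowRoot5<aboveRoot5 {m} {+ y} {+ suc x} (inj₂ y≤m√5) (_ , m√5<x) =
  +<+ (square-cancel-< (≤-<-trans (ℤP.drop‿+≤+ y²≤5m²) (ℤP.drop‿+<+ 5m²<x²)))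
  where
  y²≤5m² : + (y * y) ℤ.≤ + (5 * (m * m))
  y²≤5m² = subst₂ ℤ._≤_ (pos-square y) (pos-5square m) y≤m√5
  5m²<x² : + (5 * (m * m)) ℤ.< + (suc x * suc x)
  5m²<x² = subst₂ ℤ._<_ (pos-5square m) (pos-square (suc x)) m√5<x

offset-≡ : ∀ {q k a} → 2 * k ≡ 3 * q + a → offset q k ≡ + a
offset-≡ {q} {k} {a} 2k≡3q+a = begin
  + 2 ℤ.* + k ℤ.- + 3 ℤ.* + q      ≡⟨ cong₂ ℤ._-_ (ℤP.pos-* 2 k) (ℤP.pos-* 3 q) ⟨
  + (2 * k) ℤ.- + (3 * q)          ≡⟨ cong (λ t → + t ℤ.- + (3 * q)) 2k≡3q+a ⟩
  + (3 * q) ℤ.+ + a ℤ.- + (3 * q)  ≡⟨ cancel (+ (3 * q)) (+ a) ⟩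
  + a                              ∎
  where
  open ≡-Reasoning
  cancel : ∀ i j → i ℤ.+ j ℤ.- i ≡ j
  cancel = ℤSolver.solve-∀

offset-step : ∀ q {k k′} → k < k′ → offset q k ℤ.+ + 2 ℤ.≤ offset q k′
offset-step q {k} {k′} k<k′ = begin
  offset q k ℤ.+ + 2                ≡⟨ shift (+ k) (+ 3 ℤ.* + q) ⟩
  + 2 ℤ.* + suc k ℤ.- + 3 ℤ.* + q
    ≤⟨ ℤP.+-monoˡ-≤ (ℤ.- (+ 3 ℤ.* + q)) (ℤP.*-monoˡ-≤-nonNeg (+ 2) (+≤+ k<k′)) ⟩
  offset q k′                       ∎
  where
  open ℤP.≤-Reasoning
  shift : ∀ i j → + 2 ℤ.* i ℤ.- j ℤ.+ + 2 ≡ + 2 ℤ.* (+ 1 ℤ.+ i) ℤ.- j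
  shift = ℤSolver.solve-∀

isFloor-unique : ∀ {q k k′} → IsFloorMulPhiSq q k → IsFloorMulPhiSq q k′ → k ≡ k′
isFloor-unique {q} {k} {k′} (below , above) (below′ , above′) with <-cmp k k′
... | tri< k<k′ _ _ = ⊥-elim (ℤP.<⇒≱ (belowRoot5<aboveRoot5 {q} below′ above) (offset-step q k<k′))
... | tri≈ _ k≡k′ _ = k≡k′
... | tri> _ _ k′<k = ⊥-elim (ℤP.<⇒≱ (belowRoot5<aboveRoot5 {q} below above′) (offset-step q k′<k))

G-isFloor : ∀ q → IsFloorMulPhiSq q (G q)
G-isFloor q =
  subst (λ a → BelowRoot5 q a × AboveRoot5 q (a ℤ.+ + 2))
        (sym (offset-≡ {q} {G q} (2G≡3q+α q))) (below , above)
  where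
  below : BelowRoot5 q (+ α q)
  below = inj₂ (subst₂ ℤ._≤_ (sym (pos-square (α q))) (sym (pos-5square q)) (+≤+ (proj₁ (α-bracket q))))
  above : AboveRoot5 q (+ α q ℤ.+ + 2)
  above = subst (AboveRoot5 q ∘ +_) (+-comm 2 (α q))
    (+<+ (s≤s z≤n) ,
     subst₂ ℤ._<_ (sym (pos-5square q)) (sym (pos-square (2 + α q))) (+<+ (proj₂ (α-bracket q))))

inWU⇔inRange : ∀ n → InWU n ⇔ (∃[ m ] G m ≡ n)
inWU⇔inRange n = mk⇔ (λ (m , isFloor) → m , isFloor-unique {m} (G-isFloor m) isFloor)
                     (λ (m , Gm≡n) → m , subst (IsFloorMulPhiSq m) Gm≡n (G-isFloor m))

proposition5p10 : (n : ℕ) → (wLim n ≡ just 0) ⇔ InWU n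
proposition5p10 n = ⇔-sym (inWU⇔inRange n) ⇔-∘ wLim-zero⇔inRange n (λ {j} _ → blockStart-wLim≡G j)
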